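{- Let $p$ be a prime number. The $p$-adic Liouville number $$\xi_{\infty}:= \sum_{j=1}^{\infty} p^{j!}$$ satisfies $\widehat{\mu}^{\times}(\xi_{\infty})=3$. Consequently, $3$ belongs to the set of values $\{\widehat{\mu}^{\times}(\xi) : \xi \in \mathbb{Q}_p \text{ irrational}\}$.
   Context: $|\cdot|_p$ is the $p$-adic absolute value with $|p|_p=p^{ -1}$. A $p$-adic Liouville number is an irrational $p$-adic number $\xi$ whose irrationality exponent $\mu(\xi)$ is infinite, where $\mu(\xi)$ is the supremum of the real $\mu$ for which $0 < |y\xi - x|_p \le \max\{|x|,|y|\}^{ -\mu}$ has infinitely many solutions in nonzero integers $x,y$. For an irrational $p$-adic $\xi$, $\widehat{\mu}^{\times}(\xi)$ is the supremum of the real numbers $\widehat{\mu}^\times$ such that for every sufficiently large real $X$ the system $0 < |xy|^{1/2} \le X$, $|y\xi - x|_p \le X^{ -\widehat{\mu}^\times}$ has a solution in integers $x,y$. -}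

module Defs where

open import Data.Nat as ℕ using (ℕ; zero; suc; _!; _≡ᵇ_)
open import Data.Bool using (Bool; true; false; if_then_else_)
open import Data.List using (List; upTo)
open import Data.Bool.ListAction using (any)
open import Data.Integer as ℤ using (ℤ; +_; ∣_∣)
open import Data.Integer.Divisibility using (_∣_)
open import Data.Product using (Σ; ∃; ∃-syntax; _×_)
open import Relation.Binary.PropositionalEquality using (_≡_; _≢_)
open import Relation.Nullary using (¬_)

-- A p-adic integer is represented by its sequence of p-adic digits
-- (ξ = Σ_{i ≥ 0} d i * p^i).
Digits : Set
Digits = ℕ → ℕ

trunc : ℕ → Digits → ℕ → ℤ
trunc p d zero    = + 0
trunc p d (suc k) = trunc p d k ℤ.+ + (d k ℕ.* p ℕ.^ k)

-- |y ξ - x|_p ≤ p^{-k}   ⟺   p^k ∣ y * (ξ mod p^k) - x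
Approx : ℕ → Digits → ℕ → ℤ → ℤ → Set
Approx p d k y x = (+ (p ℕ.^ k)) ∣ (y ℤ.* trunc p d k ℤ.- x)

-- ξ is irrational: y ξ ≠ x for all integers x and y ≠ 0
Irrational : ℕ → Digits → Set
Irrational p d = ∀ (x y : ℤ) → y ≢ + 0 → ∃[ k ] ¬ Approx p d k y x

-- is i = j! for some j ≥ 1 ?  (such j satisfies j ≤ i, so search 1..i)
isFact : ℕ → Bool
isFact i = any (λ j → (suc j) ! ≡ᵇ i) (upTo i)

ξ∞ : Digits
ξ∞ i = if isFact i then 1 else 0

-- |y ξ - x|_p ≤ X^{-a/b}  (b ≥ 1):  ∃ k with X^a ≤ p^{k b} and |yξ-x|_p ≤ p^{-k}
SmallAt : ℕ → Digits → ℕ → ℕ → ℕ → ℤ → ℤ → Set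
SmallAt p d a b X y x = ∃[ k ] ((X ℕ.^ a ℕ.≤ p ℕ.^ (k ℕ.* b)) × Approx p d k y x)

-- "μ = a / b is admissible for μ̂^×(ξ)": for every sufficiently large X the system
--   0 < |xy|^{1/2} ≤ X ,  |yξ - x|_p ≤ X^{-μ}
-- has an integer solution.
UniformMult : ℕ → Digits → ℕ → ℕ → Set
UniformMult p d a b =
  ∃[ X₀ ] ∀ (X : ℕ) → X₀ ℕ.≤ X →
    ∃[ x ] ∃[ y ] (x ≢ + 0 × y ≢ + 0 × ∣ x ℤ.* y ∣ ℕ.≤ X ℕ.^ 2 × SmallAt p d a b X y x)

-- μ̂^×(ξ) = 3 : every positive rational μ = a/(b+1) < 3 is admissible, none > 3 is.
MuHatTimesIs3 : ℕ → Digits → Set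
MuHatTimesIs3 p d =
  (∀ (a b : ℕ) → a ℕ.< 3 ℕ.* suc b → UniformMult p d a (suc b)) ×
  (∀ (a b : ℕ) → 3 ℕ.* suc b ℕ.< a → ¬ UniformMult p d a (suc b))

{-# OPTIONS --safe #-}
module Submission where

-- Every truncation of ξ∞ at a level in ((n+1)!, (n+2)!] equals q = Σ_{j ≤ n+1} p^{j!} < p^{(n+1)!+1}, a number
-- far smaller than p^{(n+2)!}. Irrationality: if p^k divided yξ∞ - x for k at the ends of two consecutive such
-- gaps, both yq = x and y(q + p^{(n+2)!}) = x would hold. Lower bound: for p^e ≤ X < p^{e+1} choose the gap
-- with (n+1)! < 2e ≤ (n+2)! and m ≈ e - (n+1)!/2; the pair (p^m q, p^m) has |xy| ≤ X² and yξ∞ - x is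
-- divisible by p^{(n+2)!+m}, where (n+2)! + m ≈ 3e. Upper bound: for X = G = p^g with g ≈ (n+2)!/2, an exponent
-- above 3 forces y(q + GR) ≡ x mod G²R with p^{(n+2)!} = GR, which has no solution with |xy| ≤ G².

open import Defs
open import Data.Bool using (T; true; false)
open import Data.Empty using (⊥; ⊥-elim)
open import Data.Integer as ℤ using (ℤ; +_; ∣_∣; 0ℤ)
import Data.Integer.Properties as ℤ
open import Data.Integer.Divisibility.Signed using (divides; ∣ᵤ⇒∣; ∣⇒∣ᵤ; ∣-refl; ∣-trans; ∣m+n∣n⇒∣m; ∣n⇒∣m*n)
  renaming (_∣_ to _∣ℤ_)
open import Data.Integer.Tactic.RingSolver renaming (solve-∀ to ℤ-solve-∀)
open import Data.List using (upTo)
open import Data.List.Membership.Propositional using (lose)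
open import Data.List.Membership.Propositional.Properties using (∈-upTo⁺)
open import Data.List.Relation.Unary.Any using (satisfied)
open import Data.List.Relation.Unary.Any.Properties using (any⁺; any⁻)
open import Data.Nat as ℕ using (ℕ; zero; suc; _!; _+_; _*_; _^_; _∸_; _≤_; _<_; z≤n; s≤s; z<s; NonTrivial)
open import Data.Nat.Divisibility using (_∣_; _∣?_; >⇒∤; m∣m*n)
open import Data.Nat.Primality using (Prime; prime)
open import Data.Nat.Properties
open import Data.Nat.Tactic.RingSolver using (solve-∀)
open import Data.Product using (∃-syntax; _×_; _,_)
open import Data.Sum using (inj₁; inj₂)
open import Relation.Binary.PropositionalEquality
open import Relation.Nullary using (¬_; Dec; yes; no; contradiction)

!-mono-≤ : ∀ {m n} → m ≤ n → m ! ≤ n !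
!-mono-≤ {n = zero}  z≤n       = ≤-refl
!-mono-≤ {zero}  {suc n} z≤n   = 1≤n! (suc n)
!-mono-≤ {suc m} {suc n} (s≤s m≤n) = *-mono-≤ (s≤s m≤n) (!-mono-≤ m≤n)

[1+n]!<[2+n]! : ∀ n → suc n ! < suc (suc n) !
[1+n]!<[2+n]! n = m<m+n (suc n !) (*-mono-≤ {1} {suc n} (s≤s z≤n) (1≤n! (suc n)))

n<[1+n]! : ∀ n → n < suc n !
n<[1+n]! n = <-≤-trans (n<1+n n) (m≤m*n (suc n) (n !) {{n !≢0}})

n+[1+n]!<[2+n]! : ∀ n → n + suc n ! < suc (suc n) !
n+[1+n]!<[2+n]! n = begin-strict
  n + suc n !               <⟨ +-monoˡ-< (suc n !) (n<1+n n) ⟩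
  suc n + suc n !           ≤⟨ +-monoˡ-≤ (suc n !) (m≤m*n (suc n) (suc n !) {{suc n !≢0}}) ⟩
  suc n * suc n ! + suc n ! ≡⟨ +-comm (suc n * suc n !) (suc n !) ⟩
  suc (suc n) !             ∎
  where open ≤-Reasoning

!-cancel-< : ∀ {m n} → m ! < n ! → m < n
!-cancel-< {m} {n} m!<n! with m <? n
... | yes m<n = m<n
... | no  m≮n = contradiction m!<n! (≤⇒≯ (!-mono-≤ (≮⇒≥ m≮n)))

!-bracket : ∀ t → 2 ≤ t → ∃[ n ] (suc n ! < t × t ≤ suc (suc n) !)
!-bracket t 2≤t with m≤n⇒∃[o]m+o≡n 2≤t
... | u , refl = bracket u
  where
  bracket : ∀ u → ∃[ n ] (suc n ! < 2 + u × 2 + u ≤ suc (suc n) !)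
  bracket zero = 0 , s≤s (s≤s z≤n) , s≤s (s≤s z≤n)
  bracket (suc u) with bracket u
  ... | n , lo , hi with m≤n⇒m<n∨m≡n hi
  ...   | inj₁ lt = n , m≤n⇒m≤1+n lo , lt
  ...   | inj₂ eq = suc n , subst (_< 3 + u) eq (n<1+n _) ,
                      subst (λ z → suc z ≤ suc (suc (suc n)) !) (sym eq) ([1+n]!<[2+n]! (suc n))

ξ∞-[1+n]! : ∀ n → ξ∞ (suc n !) ≡ 1
ξ∞-[1+n]! n = digit≡1 {suc n !} (any⁺ _ (lose (∈-upTo⁺ (n<[1+n]! n)) (≡⇒≡ᵇ (suc n !) (suc n !) refl)))
  where
  digit≡1 : ∀ {i} → T (isFact i) → ξ∞ i ≡ 1
  digit≡1 {i} t with isFact i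
  ... | true = refl

!≢-in-gap : ∀ n j {i} → suc n ! < i → i < suc (suc n) ! → suc j ! ≢ i
!≢-in-gap n j lo hi refl with suc j ≤? suc n
... | yes j≤n = <-irrefl refl (≤-<-trans (!-mono-≤ j≤n) lo)
... | no  j≰n = <-irrefl refl (<-≤-trans hi (!-mono-≤ (≰⇒> j≰n)))

ξ∞-gap : ∀ n {i} → suc n ! < i → i < suc (suc n) ! → ξ∞ i ≡ 0
ξ∞-gap n {i} lo hi with isFact i in eq
... | false = refl
... | true with satisfied (any⁻ _ (upTo i) (subst T (sym eq) _))
...   | j , j!≡i = ⊥-elim (!≢-in-gap n j lo hi (≡ᵇ⇒≡ _ _ j!≡i))

ξ∞≤1 : ∀ i → ξ∞ i ≤ 1
ξ∞≤1 i with isFact i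
... | true  = ≤-refl
... | false = z≤n

halve : ∀ r → ∃[ m ] (2 * m ≤ r × r ≤ suc (2 * m))
halve zero = 0 , z≤n , z≤n
halve (suc r) with halve r
... | m , lo , hi with m≤n⇒m<n∨m≡n hi
...   | inj₁ r<1+2m = m , m≤n⇒m≤1+n lo , r<1+2m
...   | inj₂ refl   = suc m , ≤-reflexive (2[1+m] m) , ≤-trans (≤-reflexive (sym (2[1+m] m))) (n≤1+n _)
  where
  2[1+m] : ∀ m → 2 * suc m ≡ suc (suc (2 * m))
  2[1+m] = solve-∀

split-evenly : ∀ {K t} → K ≤ t → ∃[ m ] (m + K + m ≤ t × t ≤ m + suc K + m)
split-evenly {K} K≤t with m≤n⇒∃[o]m+o≡n K≤t
... | r , refl with halve r
...   | m , 2m≤r , r≤1+2m =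
  m , ≤-trans (≤-reflexive (regroup₁ m K)) (+-monoʳ-≤ K 2m≤r) , ≤-trans (+-monoʳ-≤ K r≤1+2m) (≤-reflexive (regroup₂ m K))
  where
  regroup₁ : ∀ m K → m + K + m ≡ K + 2 * m
  regroup₁ = solve-∀
  regroup₂ : ∀ m K → K + suc (2 * m) ≡ m + suc K + m
  regroup₂ = solve-∀

near-half : ∀ N → 2 ≤ N → ∃[ g ] (2 * g + 2 ≤ N × N ≤ 2 * g + 3)
near-half N 2≤N with m≤n⇒∃[o]m+o≡n 2≤N
... | r , refl with halve r
...   | g , 2g≤r , r≤1+2g =
  g , subst (_≤ 2 + r) (+-comm 2 (2 * g)) (+-monoʳ-≤ 2 2g≤r) , subst (2 + r ≤_) (+-comm 3 (2 * g)) (+-monoʳ-≤ 2 r≤1+2g)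

pos≢0 : ∀ {k} → 1 ≤ k → + k ≢ 0ℤ
pos≢0 {suc _} _ ()

∣-small⇒≡0 : ∀ {m} {e : ℤ} → + m ∣ℤ e → ∣ e ∣ < m → e ≡ 0ℤ
∣-small⇒≡0 {m} {e} m∣e ∣e∣<m with ∣ e ∣ in eq
... | zero  = ℤ.∣i∣≡0⇒i≡0 eq
... | suc _ = contradiction (subst (m ∣_) eq (∣⇒∣ᵤ m∣e)) (>⇒∤ ∣e∣<m)

1≤∣∣ : ∀ {z} → z ≢ 0ℤ → 1 ≤ ∣ z ∣
1≤∣∣ {z} z≢0 = ℕ.>-nonZero⁻¹ ∣ z ∣ {{ℕ.≢-nonZero (λ ∣z∣≡0 → z≢0 (ℤ.∣i∣≡0⇒i≡0 ∣z∣≡0))}}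

i≡j-k⇒∣i∣≤∣j∣+∣k∣ : ∀ {i} j k → i ≡ j ℤ.- k → ∣ i ∣ ≤ ∣ j ∣ + ∣ k ∣
i≡j-k⇒∣i∣≤∣j∣+∣k∣ j k refl = ℤ.∣i-j∣≤∣i∣+∣j∣ j k

-- No pair with |xy| ≤ G² satisfies y(q + GR) ≡ x mod G²R: with α = y - sG and w = sq + αR the congruence
-- splits into αGR = x - yq and Gw = x - αq, and every case for α and w contradicts the size bound.
module CloseSmallPair
  {G R q U : ℕ} (G≥1 : 1 ≤ G) (4G≤R : 4 * G ≤ R) (2≤q : 2 ≤ q) (q<U : q < U) (2U²≤G : 2 * (U * U) ≤ G)
  {x y s : ℤ} (x≢0 : x ≢ 0ℤ) (y≢0 : y ≢ 0ℤ) (xy≤G² : ∣ x ∣ * ∣ y ∣ ≤ G * G)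
  (close : y ℤ.* (+ q ℤ.+ + G ℤ.* + R) ℤ.- x ≡ s ℤ.* (+ G ℤ.* + R ℤ.* + G))
  where

  open ≤-Reasoning

  X = ∣ x ∣
  Y = ∣ y ∣
  S = ∣ s ∣
  P = G * R
  α = y ℤ.- s ℤ.* + G
  w = s ℤ.* + q ℤ.+ α ℤ.* + R
  A = ∣ α ∣

  G²≥1 : 1 ≤ G * G
  G²≥1 = *-mono-≤ G≥1 G≥1

  U≤G : U ≤ G
  U≤G = ≤-trans (m≤m*n U U {{ℕ.>-nonZero (≤-trans (s≤s z≤n) q<U)}}) (≤-trans (m≤n*m (U * U) 2) 2U²≤G)

  q≤G² : q ≤ G * G
  q≤G² = ≤-trans (<⇒≤ q<U) (≤-trans U≤G (m≤m*n G G {{ℕ.>-nonZero G≥1}}))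

  4G²≤P : 4 * (G * G) ≤ P
  4G²≤P = begin
    4 * (G * G) ≡⟨ regroup G ⟩
    G * (4 * G) ≤⟨ *-monoʳ-≤ G 4G≤R ⟩
    P           ∎
    where
    regroup : ∀ G → 4 * (G * G) ≡ G * (4 * G)
    regroup = solve-∀

  x≡y[q+GR]-sGRG : x ≡ y ℤ.* (+ q ℤ.+ + G ℤ.* + R) ℤ.- s ℤ.* (+ G ℤ.* + R ℤ.* + G)
  x≡y[q+GR]-sGRG = trans (solve-x x y (+ q) (+ G ℤ.* + R)) (cong (λ z → y ℤ.* (+ q ℤ.+ + G ℤ.* + R) ℤ.- z) close)
    where
    solve-x : ∀ x y q P → x ≡ y ℤ.* (q ℤ.+ P) ℤ.- (y ℤ.* (q ℤ.+ P) ℤ.- x)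
    solve-x = ℤ-solve-∀

  αP≡x-yq : α ℤ.* + P ≡ x ℤ.- y ℤ.* + q
  αP≡x-yq = trans (cong (α ℤ.*_) (ℤ.pos-* G R))
                  (trans (identity y s (+ q) (+ G) (+ R)) (cong (ℤ._- y ℤ.* + q) (sym x≡y[q+GR]-sGRG)))
    where
    identity : ∀ y s q G R →
               (y ℤ.- s ℤ.* G) ℤ.* (G ℤ.* R) ≡ (y ℤ.* (q ℤ.+ G ℤ.* R) ℤ.- s ℤ.* (G ℤ.* R ℤ.* G)) ℤ.- y ℤ.* q
    identity = ℤ-solve-∀

  sG≡y-α : s ℤ.* + G ≡ y ℤ.- α
  sG≡y-α = identity y (s ℤ.* + G)
    where
    identity : ∀ y t → t ≡ y ℤ.- (y ℤ.- t)
    identity = ℤ-solve-∀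

  Gw≡x-αq : + G ℤ.* w ≡ x ℤ.- α ℤ.* + q
  Gw≡x-αq = trans (identity y s (+ q) (+ G) (+ R)) (cong (ℤ._- α ℤ.* + q) (sym x≡y[q+GR]-sGRG))
    where
    identity : ∀ y s q G R →
               G ℤ.* (s ℤ.* q ℤ.+ (y ℤ.- s ℤ.* G) ℤ.* R) ≡
               (y ℤ.* (q ℤ.+ G ℤ.* R) ℤ.- s ℤ.* (G ℤ.* R ℤ.* G)) ℤ.- (y ℤ.- s ℤ.* G) ℤ.* q
    identity = ℤ-solve-∀

  AP≤X+Yq : A * P ≤ X + Y * q
  AP≤X+Yq = begin
    A * P             ≡⟨ ℤ.abs-* α (+ P) ⟨
    ∣ α ℤ.* + P ∣     ≤⟨ i≡j-k⇒∣i∣≤∣j∣+∣k∣ x (y ℤ.* + q) αP≡x-yq ⟩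
    X + ∣ y ℤ.* + q ∣ ≡⟨ cong (λ z → X + z) (ℤ.abs-* y (+ q)) ⟩
    X + Y * q         ∎

  SG≤Y+A : S * G ≤ Y + A
  SG≤Y+A = begin
    S * G         ≡⟨ ℤ.abs-* s (+ G) ⟨
    ∣ s ℤ.* + G ∣ ≤⟨ i≡j-k⇒∣i∣≤∣j∣+∣k∣ y α sG≡y-α ⟩
    Y + A         ∎

  G∣w∣≤X+Aq : G * ∣ w ∣ ≤ X + A * q
  G∣w∣≤X+Aq = begin
    G * ∣ w ∣         ≡⟨ ℤ.abs-* (+ G) w ⟨
    ∣ + G ℤ.* w ∣     ≤⟨ i≡j-k⇒∣i∣≤∣j∣+∣k∣ x (α ℤ.* + q) Gw≡x-αq ⟩
    X + ∣ α ℤ.* + q ∣ ≡⟨ cong (λ z → X + z) (ℤ.abs-* α (+ q)) ⟩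
    X + A * q         ∎

  X≥1 : 1 ≤ X
  X≥1 = 1≤∣∣ x≢0

  Y≥1 : 1 ≤ Y
  Y≥1 = 1≤∣∣ y≢0

  Y≤G² : Y ≤ G * G
  Y≤G² = ≤-trans (m≤n*m Y X {{ℕ.>-nonZero X≥1}}) xy≤G²

  α≡0-impossible : α ≢ 0ℤ
  α≡0-impossible α≡0 = <-irrefl refl (begin-strict
    G * G       <⟨ m<m+n (G * G) (subst (1 ≤_) (sym (+-identityʳ (G * G))) G²≥1) ⟩
    2 * (G * G) ≤⟨ *-monoˡ-≤ (G * G) 2≤q ⟩
    q * (G * G) ≤⟨ *-monoʳ-≤ q (*-mono-≤ G≤Y G≤Y) ⟩
    q * (Y * Y) ≡⟨ regroup q Y ⟩
    Y * q * Y   ≡⟨ cong (_* Y) X≡Yq ⟨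
    X * Y       ≤⟨ xy≤G² ⟩
    G * G       ∎)
    where
    regroup : ∀ q Y → q * (Y * Y) ≡ Y * q * Y
    regroup = solve-∀
    X≡Yq : X ≡ Y * q
    X≡Yq = trans (cong ∣_∣ (ℤ.i-j≡0⇒i≡j x (y ℤ.* + q) (trans (sym αP≡x-yq) (cong (ℤ._* + P) α≡0)))) (ℤ.abs-* y (+ q))
    y≡sG : y ≡ s ℤ.* + G
    y≡sG = ℤ.i-j≡0⇒i≡j y (s ℤ.* + G) α≡0
    G≤Y : G ≤ Y
    G≤Y = begin
      G             ≤⟨ m≤n*m G S {{ℕ.>-nonZero (1≤∣∣ {s} λ s≡0 → y≢0 (trans y≡sG (cong (ℤ._* + G) s≡0)))}} ⟩
      S * G         ≡⟨ ℤ.abs-* s (+ G) ⟨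
      ∣ s ℤ.* + G ∣ ≡⟨ cong ∣_∣ y≡sG ⟨
      Y             ∎

  large-α-impossible : 1 ≤ A → 2 * (Y * q) ≤ A * P → ⊥
  large-α-impossible A≥1 2Yq≤AP = <-irrefl refl (begin-strict
    2 * (G * G) <⟨ *-monoˡ-< (G * G) {{ℕ.>-nonZero G²≥1}} {2} {4} (s≤s (s≤s (s≤s z≤n))) ⟩
    4 * (G * G) ≤⟨ 4G²≤P ⟩
    P           ≤⟨ m≤n*m P A {{ℕ.>-nonZero A≥1}} ⟩
    A * P       ≤⟨ AP≤2X ⟩
    2 * X       ≤⟨ *-monoʳ-≤ 2 (m≤m*n X Y {{ℕ.>-nonZero Y≥1}}) ⟩
    2 * (X * Y) ≤⟨ *-monoʳ-≤ 2 xy≤G² ⟩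
    2 * (G * G) ∎)
    where
    AP≤2X : A * P ≤ 2 * X
    AP≤2X = +-cancelʳ-≤ (A * P) _ _ (begin
      A * P + A * P       ≡⟨ cong (λ z → A * P + z) (+-identityʳ (A * P)) ⟨
      2 * (A * P)         ≤⟨ *-monoʳ-≤ 2 AP≤X+Yq ⟩
      2 * (X + Y * q)     ≡⟨ *-distribˡ-+ 2 X (Y * q) ⟩
      2 * X + 2 * (Y * q) ≤⟨ +-monoʳ-≤ (2 * X) 2Yq≤AP ⟩
      2 * X + A * P       ∎)

  w≡0⇒X≡Aq : w ≡ 0ℤ → X ≡ A * q
  w≡0⇒X≡Aq w≡0 = trans (cong ∣_∣ x≡αq) (ℤ.abs-* α (+ q))
    where
    x≡αq : x ≡ α ℤ.* + q
    x≡αq = ℤ.i-j≡0⇒i≡j x (α ℤ.* + q) (trans (sym Gw≡x-αq) (trans (cong (+ G ℤ.*_) w≡0) (ℤ.*-zeroʳ (+ G))))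

  w≡0⇒Sq≡AR : w ≡ 0ℤ → S * q ≡ A * R
  w≡0⇒Sq≡AR w≡0 = begin-equality
    S * q               ≡⟨ ℤ.abs-* s (+ q) ⟨
    ∣ s ℤ.* + q ∣       ≡⟨ cong ∣_∣ sq≡-αR ⟩
    ∣ ℤ.- (α ℤ.* + R) ∣ ≡⟨ ℤ.∣-i∣≡∣i∣ (α ℤ.* + R) ⟩
    ∣ α ℤ.* + R ∣       ≡⟨ ℤ.abs-* α (+ R) ⟩
    A * R               ∎
    where
    identity : ∀ u v → u ≡ (u ℤ.+ v) ℤ.- v
    identity = ℤ-solve-∀
    sq≡-αR : s ℤ.* + q ≡ ℤ.- (α ℤ.* + R)
    sq≡-αR = trans (identity (s ℤ.* + q) (α ℤ.* + R)) (trans (cong (ℤ._- α ℤ.* + R) w≡0) (ℤ.+-identityˡ _))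

  w≡0-impossible : 1 ≤ A → w ≢ 0ℤ
  w≡0-impossible A≥1 w≡0 = <-irrefl refl (begin-strict
    4 * A²G²              ≡⟨ regroup₁ A G ⟩
    A * A * (4 * (G * G)) ≤⟨ *-monoʳ-≤ (A * A) 4G²≤P ⟩
    A * A * (G * R)       ≡⟨ regroup₂ A G R ⟩
    A * G * (A * R)       ≡⟨ cong (A * G *_) (w≡0⇒Sq≡AR w≡0) ⟨
    A * G * (S * q)       ≡⟨ regroup₃ A G S q ⟩
    A * q * (S * G)       ≤⟨ *-monoʳ-≤ (A * q) SG≤Y+A ⟩
    A * q * (Y + A)       ≡⟨ regroup₄ A q Y ⟩
    A * q * Y + A * A * q ≡⟨ cong (λ z → z * Y + A * A * q) (w≡0⇒X≡Aq w≡0) ⟨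
    X * Y + A * A * q     ≤⟨ +-mono-≤ xy≤G² (*-monoʳ-≤ (A * A) q≤G²) ⟩
    G * G + A²G²          ≤⟨ +-monoˡ-≤ A²G² (m≤n*m (G * G) (A * A) {{ℕ.>-nonZero (*-mono-≤ A≥1 A≥1)}}) ⟩
    A²G² + A²G²           <⟨ subst (A²G² + A²G² <_) (regroup₅ A²G²) (m<m+n _ (≤-trans A²G²≥1 (m≤m+n A²G² A²G²))) ⟩
    4 * A²G²              ∎)
    where
    A²G² = A * A * (G * G)
    A²G²≥1 : 1 ≤ A²G²
    A²G²≥1 = *-mono-≤ (*-mono-≤ A≥1 A≥1) G²≥1
    regroup₁ : ∀ A G → 4 * (A * A * (G * G)) ≡ A * A * (4 * (G * G))
    regroup₁ = solve-∀
    regroup₂ : ∀ A G R → A * A * (G * R) ≡ A * G * (A * R)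
    regroup₂ = solve-∀
    regroup₃ : ∀ A G S q → A * G * (S * q) ≡ A * q * (S * G)
    regroup₃ = solve-∀
    regroup₄ : ∀ A q Y → A * q * (Y + A) ≡ A * q * Y + A * A * q
    regroup₄ = solve-∀
    regroup₅ : ∀ t → t + t + (t + t) ≡ 4 * t
    regroup₅ = solve-∀

  small-α⇒A<q : A * P < 2 * (Y * q) → A < q
  small-α⇒A<q AP<2Yq = ≤-<-trans (m≤n*m A 2) (*-cancelˡ-< 2 (2 * A) q (subst (_< 2 * q) (*-assoc 2 2 A) 4A<2q))
    where
    regroup₁ : ∀ A G → A * (4 * (G * G)) ≡ 4 * A * (G * G)
    regroup₁ = solve-∀
    regroup₂ : ∀ G q → 2 * (G * G * q) ≡ 2 * q * (G * G)
    regroup₂ = solve-∀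
    4A<2q : 4 * A < 2 * q
    4A<2q = *-cancelʳ-< (G * G) (4 * A) (2 * q) (begin-strict
      4 * A * (G * G)   ≡⟨ regroup₁ A G ⟨
      A * (4 * (G * G)) ≤⟨ *-monoʳ-≤ A 4G²≤P ⟩
      A * P             <⟨ AP<2Yq ⟩
      2 * (Y * q)       ≤⟨ *-monoʳ-≤ 2 (*-monoˡ-≤ q Y≤G²) ⟩
      2 * (G * G * q)   ≡⟨ regroup₂ G q ⟩
      2 * q * (G * G)   ∎)

  w≢0-impossible : 1 ≤ A → A * P < 2 * (Y * q) → 1 ≤ ∣ w ∣ → ⊥
  w≢0-impossible A≥1 AP<2Yq W≥1 = <-irrefl refl (<-≤-trans G<U U≤G)
    where
    Aq<U² : A * q < U * U
    Aq<U² = <-trans (*-monoˡ-< q {{ℕ.>-nonZero (≤-trans (s≤s z≤n) 2≤q)}} (small-α⇒A<q AP<2Yq)) (*-mono-< q<U q<U)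
    G<2X : G < 2 * X
    G<2X = +-cancelʳ-< G G (2 * X) (begin-strict
      G + G               ≡⟨ cong (λ z → G + z) (*-identityˡ G) ⟨
      2 * G               ≤⟨ *-monoʳ-≤ 2 (≤-trans (m≤m*n G ∣ w ∣ {{ℕ.>-nonZero W≥1}}) G∣w∣≤X+Aq) ⟩
      2 * (X + A * q)     <⟨ *-monoʳ-< 2 (+-monoʳ-< X Aq<U²) ⟩
      2 * (X + U * U)     ≡⟨ *-distribˡ-+ 2 X (U * U) ⟩
      2 * X + 2 * (U * U) ≤⟨ +-monoʳ-≤ (2 * X) 2U²≤G ⟩
      2 * X + G           ∎)
    P<2YU : P < 2 * (Y * U)
    P<2YU = begin-strict
      P           ≤⟨ m≤n*m P A {{ℕ.>-nonZero A≥1}} ⟩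
      A * P       <⟨ AP<2Yq ⟩
      2 * (Y * q) ≤⟨ *-monoʳ-≤ 2 (*-monoʳ-≤ Y (<⇒≤ q<U)) ⟩
      2 * (Y * U) ∎
    regroup₁ : ∀ G → G * (4 * (G * G)) ≡ 4 * (G * G) * G
    regroup₁ = solve-∀
    regroup₂ : ∀ X Y U → 2 * X * (2 * (Y * U)) ≡ 4 * (X * Y) * U
    regroup₂ = solve-∀
    G<U : G < U
    G<U = *-cancelˡ-< (4 * (G * G)) G U (begin-strict
      4 * (G * G) * G       ≡⟨ regroup₁ G ⟨
      G * (4 * (G * G))     ≤⟨ *-monoʳ-≤ G 4G²≤P ⟩
      G * P                 <⟨ *-mono-< G<2X P<2YU ⟩
      2 * X * (2 * (Y * U)) ≡⟨ regroup₂ X Y U ⟩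
      4 * (X * Y) * U       ≤⟨ *-monoˡ-≤ U (*-monoʳ-≤ 4 xy≤G²) ⟩
      4 * (G * G) * U       ∎)

  impossible : ⊥
  impossible with α ℤ.≟ 0ℤ | 2 * (Y * q) ≤? A * P | w ℤ.≟ 0ℤ
  ... | yes α≡0 | _       | _       = α≡0-impossible α≡0
  ... | no  α≢0 | yes big | _       = large-α-impossible (1≤∣∣ α≢0) big
  ... | no  α≢0 | no  _   | yes w≡0 = w≡0-impossible (1≤∣∣ α≢0) w≡0
  ... | no  α≢0 | no  small | no w≢0 = w≢0-impossible (1≤∣∣ α≢0) (≰⇒> small) (1≤∣∣ w≢0)

lower-exponent : ∀ {a c e M N m} → a < 3 * c → 8 * c ≤ e → 2 * e ≤ m + suc (suc M) + m → 2 * e ≤ N → 2 * c * M ≤ N →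
                 suc e * a ≤ (N + m) * c
lower-exponent {a} {c} {e} {M} {N} {m} a<3c 8c≤e 2e≤m+[2+M]+m 2e≤N 2cM≤N =
  +-cancelʳ-≤ (suc e) _ _ (begin
    suc e * a + suc e   ≡⟨ +-comm (suc e * a) (suc e) ⟩
    suc e + suc e * a   ≡⟨ *-suc (suc e) a ⟨
    suc e * suc a       ≤⟨ *-monoʳ-≤ (suc e) a<3c ⟩
    suc e * (3 * c)     ≡⟨ *-comm (suc e) (3 * c) ⟩
    3 * c * suc e       ≤⟨ *-cancelˡ-≤ 4 quadrupled ⟩
    (N + m) * c + suc e ∎)
  where
  open ≤-Reasoning
  c≥1 : 1 ≤ c
  c≥1 = positive c a<3c
    where
    positive : ∀ c → a < 3 * c → 1 ≤ c
    positive (suc _) _ = s≤s z≤n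
  expand₁ : ∀ c e → 4 * (3 * c * suc e) ≡ 8 * c * e + 12 * c + 2 * c * (2 * e)
  expand₁ = solve-∀
  expand₂ : ∀ c e M m → 8 * c * e + 12 * c + 2 * c * (m + suc (suc M) + m) ≡ 8 * c * e + 4 * c * m + 16 * c + 2 * c * M
  expand₂ = solve-∀
  collect : ∀ c e m s → 8 * c * e + 4 * c * m + 2 * e + (2 * e + 4 * (s * c)) + 4 ≡ 4 * ((2 * e + s + m) * c + suc e)
  collect = solve-∀
  quadrupled : 4 * (3 * c * suc e) ≤ 4 * ((N + m) * c + suc e)
  quadrupled with m≤n⇒∃[o]m+o≡n 2e≤N
  ... | s , refl = begin
    4 * (3 * c * suc e)                                       ≡⟨ expand₁ c e ⟩
    8 * c * e + 12 * c + 2 * c * (2 * e)                      ≤⟨ +-monoʳ-≤ (8 * c * e + 12 * c) (*-monoʳ-≤ (2 * c) 2e≤m+[2+M]+m) ⟩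
    8 * c * e + 12 * c + 2 * c * (m + suc (suc M) + m)        ≡⟨ expand₂ c e M m ⟩
    8 * c * e + 4 * c * m + 16 * c + 2 * c * M                ≤⟨ +-monoʳ-≤ (8 * c * e + 4 * c * m + 16 * c) 2cM≤N ⟩
    8 * c * e + 4 * c * m + 16 * c + (2 * e + s)              ≤⟨ +-monoˡ-≤ (2 * e + s) (+-monoʳ-≤ (8 * c * e + 4 * c * m) 16c≤2e) ⟩
    8 * c * e + 4 * c * m + 2 * e + (2 * e + s)               ≤⟨ +-monoʳ-≤ (8 * c * e + 4 * c * m + 2 * e) (+-monoʳ-≤ (2 * e) s≤4sc) ⟩
    8 * c * e + 4 * c * m + 2 * e + (2 * e + 4 * (s * c))     ≤⟨ m≤m+n _ 4 ⟩
    8 * c * e + 4 * c * m + 2 * e + (2 * e + 4 * (s * c)) + 4 ≡⟨ collect c e m s ⟩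
    4 * ((2 * e + s + m) * c + suc e)                         ∎
    where
    16c≤2e : 16 * c ≤ 2 * e
    16c≤2e = ≤-trans (≤-reflexive (*-assoc 2 8 c)) (*-monoʳ-≤ 2 8c≤e)
    s≤4sc : s ≤ 4 * (s * c)
    s≤4sc = ≤-trans (m≤m*n s c {{ℕ.>-nonZero c≥1}}) (m≤n*m (s * c) 4)

upper-exponent : ∀ {a c g k N} → 3 * c < a → 2 * c < g → N ≤ 2 * g + 3 → g * a ≤ k * c → N + g ≤ k
upper-exponent {a} {c} {g} {k} {N} 3c<a 2c<g N≤2g+3 ga≤kc with N + g ≤? k
... | yes N+g≤k = N+g≤k
... | no  N+g≰k = contradiction 2c<g (≤⇒≯ (+-cancelʳ-≤ c g (2 * c) (+-cancelˡ-≤ (3 * g * c) _ _ (begin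
    3 * g * c + (g + c)     ≡⟨ expand₁ g c ⟨
    g * suc (3 * c) + c     ≤⟨ +-monoˡ-≤ c (≤-trans (*-monoʳ-≤ g 3c<a) ga≤kc) ⟩
    k * c + c               ≡⟨ +-comm (k * c) c ⟩
    suc k * c               ≤⟨ *-monoˡ-≤ c (≤-trans (≰⇒> N+g≰k) (+-monoˡ-≤ g N≤2g+3)) ⟩
    (2 * g + 3 + g) * c     ≡⟨ expand₂ g c ⟩
    3 * g * c + (2 * c + c) ∎))))
  where
  open ≤-Reasoning
  expand₁ : ∀ g c → g * suc (3 * c) + c ≡ 3 * g * c + (g + c)
  expand₁ = solve-∀
  expand₂ : ∀ g c → (2 * g + 3 + g) * c ≡ 3 * g * c + (2 * c + c)
  expand₂ = solve-∀

module _ (p : ℕ) .{{_ : NonTrivial p}} where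

  instance
    p≢0 : ℕ.NonZero p
    p≢0 = ℕ.nonTrivial⇒nonZero p

  1<p : 1 < p
  1<p = ℕ.nonTrivial⇒n>1 p

  n<p^n : ∀ n → n < p ^ n
  n<p^n zero    = z<s
  n<p^n (suc n) = ≤-<-trans (n<p^n n) (^-monoʳ-< p 1<p (n<1+n n))

  ^-cancelʳ-≤ : ∀ {m n} → p ^ m ≤ p ^ n → m ≤ n
  ^-cancelʳ-≤ {m} {n} p^m≤p^n with m ≤? n
  ... | yes m≤n = m≤n
  ... | no  m≰n = contradiction p^m≤p^n (<⇒≱ (^-monoʳ-< p 1<p (≰⇒> m≰n)))

  ^-cancelʳ-< : ∀ {m n} → p ^ m < p ^ n → m < n
  ^-cancelʳ-< {m} {n} p^m<p^n with m <? n
  ... | yes m<n = m<n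
  ... | no  m≮n = contradiction p^m<p^n (≤⇒≯ (^-monoʳ-≤ p (≮⇒≥ m≮n)))

  log-bracket : ∀ X → 1 ≤ X → ∃[ e ] (p ^ e ≤ X × X < p ^ suc e)
  log-bracket X 1≤X = search X (n<p^n X)
    where
    search : ∀ j → X < p ^ j → ∃[ e ] (p ^ e ≤ X × X < p ^ suc e)
    search zero    X<1 = contradiction 1≤X (<⇒≱ X<1)
    search (suc j) X<p^[1+j] with X <? p ^ j
    ... | yes X<p^j = search j X<p^j
    ... | no  X≮p^j = j , ≮⇒≥ X≮p^j , X<p^[1+j]

  4p^g≤p^r : ∀ {g r} → 2 + g ≤ r → 4 * p ^ g ≤ p ^ r
  4p^g≤p^r {g} {r} 2+g≤r = begin
    4 * p ^ g       ≡⟨ *-assoc 2 2 (p ^ g) ⟩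
    2 * (2 * p ^ g) ≤⟨ *-mono-≤ 1<p (*-monoˡ-≤ (p ^ g) 1<p) ⟩
    p ^ (2 + g)     ≤⟨ ^-monoʳ-≤ p 2+g≤r ⟩
    p ^ r           ∎
    where open ≤-Reasoning

  2[p^[1+M]]²≤p^g : ∀ {M g} → 2 * M + 3 ≤ g → 2 * (p ^ suc M * p ^ suc M) ≤ p ^ g
  2[p^[1+M]]²≤p^g {M} {g} 2M+3≤g = begin
    2 * (p ^ suc M * p ^ suc M) ≤⟨ *-monoˡ-≤ (p ^ suc M * p ^ suc M) 1<p ⟩
    p * (p ^ suc M * p ^ suc M) ≡⟨ cong (p *_) (^-distribˡ-+-* p (suc M) (suc M)) ⟨
    p ^ suc (suc M + suc M)     ≤⟨ ^-monoʳ-≤ p (≤-trans (≤-reflexive (regroup M)) 2M+3≤g) ⟩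
    p ^ g                       ∎
    where
    open ≤-Reasoning
    regroup : ∀ M → suc (suc M + suc M) ≡ 2 * M + 3
    regroup = solve-∀

  truncℕ : Digits → ℕ → ℕ
  truncℕ d zero    = 0
  truncℕ d (suc k) = truncℕ d k + d k * p ^ k

  trunc≡truncℕ : ∀ d k → trunc p d k ≡ + truncℕ d k
  trunc≡truncℕ d zero    = refl
  trunc≡truncℕ d (suc k) = cong (ℤ._+ + (d k * p ^ k)) (trunc≡truncℕ d k)

  truncℕ-+ : ∀ d k j → ∃[ r ] truncℕ d (k + j) ≡ truncℕ d k + r * p ^ k
  truncℕ-+ d k zero    = 0 , trans (cong (truncℕ d) (+-identityʳ k)) (sym (+-identityʳ _))
  truncℕ-+ d k (suc j) with truncℕ-+ d k j
  ... | r , eq = r + d (k + j) * p ^ j , (begin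
      truncℕ d (k + suc j)                                 ≡⟨ cong (truncℕ d) (+-suc k j) ⟩
      truncℕ d (k + j) + d (k + j) * p ^ (k + j)           ≡⟨ cong₂ _+_ eq (cong (d (k + j) *_) (^-distribˡ-+-* p k j)) ⟩
      truncℕ d k + r * p ^ k + d (k + j) * (p ^ k * p ^ j) ≡⟨ regroup (truncℕ d k) r (d (k + j)) (p ^ k) (p ^ j) ⟩
      truncℕ d k + (r + d (k + j) * p ^ j) * p ^ k         ∎)
    where
    open ≡-Reasoning
    regroup : ∀ t r a P Q → t + r * P + a * (P * Q) ≡ t + (r + a * Q) * P
    regroup = solve-∀

  truncℕ<p^ : ∀ {d} → (∀ i → d i < p) → ∀ k → truncℕ d k < p ^ k
  truncℕ<p^ d<p zero    = z<s
  truncℕ<p^ {d} d<p (suc k) = begin-strict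
    truncℕ d k + d k * p ^ k <⟨ +-monoˡ-< (d k * p ^ k) (truncℕ<p^ d<p k) ⟩
    suc (d k) * p ^ k        ≤⟨ *-monoˡ-≤ (p ^ k) (d<p k) ⟩
    p * p ^ k                ∎
    where open ≤-Reasoning

  Approx⇒∣ : ∀ {d k y x} → Approx p d k y x → + (p ^ k) ∣ℤ y ℤ.* + truncℕ d k ℤ.- x
  Approx⇒∣ {d} {k} {y} {x} a = subst (λ t → + (p ^ k) ∣ℤ y ℤ.* t ℤ.- x) (trunc≡truncℕ d k) (∣ᵤ⇒∣ a)

  ∣⇒Approx : ∀ {d k y x} → + (p ^ k) ∣ℤ y ℤ.* + truncℕ d k ℤ.- x → Approx p d k y x
  ∣⇒Approx {d} {k} {y} {x} a = ∣⇒∣ᵤ (subst (λ t → + (p ^ k) ∣ℤ y ℤ.* t ℤ.- x) (sym (trunc≡truncℕ d k)) a)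

  Approx-≤ : ∀ d k j {y x} → Approx p d (k + j) y x → Approx p d k y x
  Approx-≤ d k j {y} {x} a with truncℕ-+ d k j
  ... | r , t[k+j]≡ = ∣⇒Approx {d} {k} {y} {x}
    (∣m+n∣n⇒∣m (subst (+ (p ^ k) ∣ℤ_) split (∣-trans p^k∣p^[k+j] (Approx⇒∣ {d} {k + j} {y} {x} a)))
                (∣n⇒∣m*n (y ℤ.* + r) ∣-refl))
    where
    open ≡-Reasoning
    t = truncℕ d k
    P = p ^ k
    p^k∣p^[k+j] : + P ∣ℤ + (p ^ (k + j))
    p^k∣p^[k+j] = ∣ᵤ⇒∣ (subst (P ∣_) (sym (^-distribˡ-+-* p k j)) (m∣m*n (p ^ j)))
    shift : ∀ y t r P x → y ℤ.* (t ℤ.+ r ℤ.* P) ℤ.- x ≡ (y ℤ.* t ℤ.- x) ℤ.+ y ℤ.* r ℤ.* P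
    shift = ℤ-solve-∀
    split : y ℤ.* + truncℕ d (k + j) ℤ.- x ≡ (y ℤ.* + t ℤ.- x) ℤ.+ y ℤ.* + r ℤ.* + P
    split = begin
      y ℤ.* + truncℕ d (k + j) ℤ.- x          ≡⟨ cong (λ u → y ℤ.* + u ℤ.- x) t[k+j]≡ ⟩
      y ℤ.* + (t + r * P) ℤ.- x               ≡⟨ cong (λ u → y ℤ.* u ℤ.- x) (trans (ℤ.pos-+ t (r * P))
                                                                               (cong (λ u → + t ℤ.+ u) (ℤ.pos-* r P))) ⟩
      y ℤ.* (+ t ℤ.+ + r ℤ.* + P) ℤ.- x       ≡⟨ shift y (+ t) (+ r) (+ P) x ⟩
      (y ℤ.* + t ℤ.- x) ℤ.+ y ℤ.* + r ℤ.* + P ∎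

  residual-bound : ∀ x y t j → t < p ^ j → ∣ y ℤ.* + t ℤ.- x ∣ < p ^ (∣ x ∣ + ∣ y ∣ + j)
  residual-bound x y t j t<p^j = begin-strict
    ∣ y ℤ.* + t ℤ.- x ∣                     ≤⟨ ℤ.∣i-j∣≤∣i∣+∣j∣ (y ℤ.* + t) x ⟩
    ∣ y ℤ.* + t ∣ + ∣ x ∣                   ≡⟨ cong (_+ ∣ x ∣) (ℤ.abs-* y (+ t)) ⟩
    ∣ y ∣ * t + ∣ x ∣                       ≤⟨ m≤m+n _ (∣ x ∣ * t + ∣ y ∣) ⟩
    ∣ y ∣ * t + ∣ x ∣ + (∣ x ∣ * t + ∣ y ∣) ≡⟨ expand ∣ x ∣ ∣ y ∣ t ⟩
    (∣ x ∣ + ∣ y ∣) * suc t                 ≤⟨ *-monoʳ-≤ (∣ x ∣ + ∣ y ∣) t<p^j ⟩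
    (∣ x ∣ + ∣ y ∣) * p ^ j                 <⟨ *-monoˡ-< (p ^ j) {{m^n≢0 p j}} (n<p^n (∣ x ∣ + ∣ y ∣)) ⟩
    p ^ (∣ x ∣ + ∣ y ∣) * p ^ j             ≡⟨ ^-distribˡ-+-* p (∣ x ∣ + ∣ y ∣) j ⟨
    p ^ (∣ x ∣ + ∣ y ∣ + j)                 ∎
    where
    open ≤-Reasoning
    expand : ∀ a b t → b * t + a + (a * t + b) ≡ (a + b) * suc t
    expand = solve-∀

  Approx⇒exact : ∀ {d k j y x} → Approx p d k y x → ∣ x ∣ + ∣ y ∣ + j ≤ k → truncℕ d k < p ^ j →
                 y ℤ.* + truncℕ d k ≡ x
  Approx⇒exact {d} {k} {j} {y} {x} a bound t<p^j = ℤ.i-j≡0⇒i≡j _ x (∣-small⇒≡0 (Approx⇒∣ {d} {k} {y} {x} a)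
    (<-≤-trans (residual-bound x y (truncℕ d k) j t<p^j) (^-monoʳ-≤ p bound)))

  truncℕ-const : ∀ {d a b} → (∀ {i} → a ≤ i → i < b → d i ≡ 0) →
                 ∀ {k} → a ≤ k → k ≤ b → truncℕ d k ≡ truncℕ d a
  truncℕ-const {d} {a} zeros {k} a≤k k≤b with m≤n⇒m<n∨m≡n a≤k
  ... | inj₂ refl = refl
  ... | inj₁ (s≤s {n = k′} a≤k′) = begin
    truncℕ d k′ + d k′ * p ^ k′ ≡⟨ cong₂ _+_ (truncℕ-const zeros a≤k′ k′≤b) (cong (_* p ^ k′) (zeros a≤k′ k≤b)) ⟩
    truncℕ d a + 0              ≡⟨ +-identityʳ (truncℕ d a) ⟩
    truncℕ d a                  ∎
    where
    open ≡-Reasoning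
    k′≤b : k′ ≤ _
    k′≤b = <⇒≤ k≤b

  ξ∞<p : ∀ i → ξ∞ i < p
  ξ∞<p i = ≤-<-trans (ξ∞≤1 i) 1<p

  -- partial n = Σ_{1 ≤ j ≤ n+1} p^(j!)
  partial : ℕ → ℕ
  partial n = truncℕ ξ∞ (suc (suc n !))

  truncℕ-gap : ∀ n {k} → suc (suc n !) ≤ k → k ≤ suc (suc n) ! → truncℕ ξ∞ k ≡ partial n
  truncℕ-gap n = truncℕ-const (ξ∞-gap n)

  p^[1+n]!≤partial : ∀ n → p ^ (suc n !) ≤ partial n
  p^[1+n]!≤partial n = begin
    p ^ (suc n !)                ≡⟨ *-identityˡ (p ^ (suc n !)) ⟨
    1 * p ^ (suc n !)            ≡⟨ cong (_* p ^ (suc n !)) (ξ∞-[1+n]! n) ⟨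
    ξ∞ (suc n !) * p ^ (suc n !) ≤⟨ m≤n+m _ (truncℕ ξ∞ (suc n !)) ⟩
    partial n                    ∎
    where open ≤-Reasoning

  2≤partial : ∀ n → 2 ≤ partial n
  2≤partial n = begin
    2             ≤⟨ 1<p ⟩
    p             ≡⟨ *-identityʳ p ⟨
    p ^ 1         ≤⟨ ^-monoʳ-≤ p (1≤n! (suc n)) ⟩
    p ^ (suc n !) ≤⟨ p^[1+n]!≤partial n ⟩
    partial n     ∎
    where open ≤-Reasoning

  partial<p^ : ∀ n → partial n < p ^ suc (suc n !)
  partial<p^ n = truncℕ<p^ ξ∞<p (suc (suc n !))

  partial-suc : ∀ n → partial (suc n) ≡ partial n + p ^ (suc (suc n) !)
  partial-suc n = begin
    truncℕ ξ∞ N + ξ∞ N * p ^ N ≡⟨ cong₂ _+_ (truncℕ-gap n ([1+n]!<[2+n]! n) ≤-refl)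
                                           (cong (_* p ^ N) (ξ∞-[1+n]! (suc n))) ⟩
    partial n + 1 * p ^ N      ≡⟨ cong (λ z → partial n + z) (*-identityˡ (p ^ N)) ⟩
    partial n + p ^ N          ∎
    where
    open ≡-Reasoning
    N = suc (suc n) !

  Approx? : ∀ d k y x → Dec (Approx p d k y x)
  Approx? d k y x = p ^ k ∣? ∣ y ℤ.* trunc p d k ℤ.- x ∣

  Approx⇒exact-at-gap : ∀ n {x y} → ∣ x ∣ + ∣ y ∣ ≤ n → Approx p ξ∞ (suc (suc n) !) y x → y ℤ.* + partial n ≡ x
  Approx⇒exact-at-gap n {x} {y} small approx = subst (λ t → y ℤ.* + t ≡ x) truncℕ-N
    (Approx⇒exact {ξ∞} {suc (suc n) !} {suc (suc n !)} {y} {x} approx level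
      (subst (_< p ^ suc (suc n !)) (sym truncℕ-N) (partial<p^ n)))
    where
    truncℕ-N = truncℕ-gap n ([1+n]!<[2+n]! n) ≤-refl
    level : ∣ x ∣ + ∣ y ∣ + suc (suc n !) ≤ suc (suc n) !
    level = ≤-trans (+-monoˡ-≤ (suc (suc n !)) small) (≤-trans (≤-reflexive (+-suc n (suc n !))) (n+[1+n]!<[2+n]! n))

  -- Approximations at the ends of two consecutive gaps would both be exact, and they differ by y p^N.
  ξ∞-irrational : Irrational p ξ∞
  ξ∞-irrational x y y≢0 = witness
    where
    n = ∣ x ∣ + ∣ y ∣
    N = suc (suc n) !

    difference : ∀ y a b → y ℤ.* (a ℤ.+ b) ℤ.- y ℤ.* a ≡ y ℤ.* b
    difference = ℤ-solve-∀

    y*p^N≡0 : Approx p ξ∞ N y x → Approx p ξ∞ (suc (suc (suc n)) !) y x → y ℤ.* + (p ^ N) ≡ 0ℤ ℤ.* + (p ^ N)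
    y*p^N≡0 a a′ = begin
      y ℤ.* + (p ^ N)                                         ≡⟨ difference y (+ partial n) (+ (p ^ N)) ⟨
      y ℤ.* (+ partial n ℤ.+ + (p ^ N)) ℤ.- y ℤ.* + partial n ≡⟨ cong (ℤ._- y ℤ.* + partial n) y*partial[1+n]≡x ⟩
      x ℤ.- y ℤ.* + partial n                                 ≡⟨ cong (λ z → x ℤ.- z) (Approx⇒exact-at-gap n {x} {y} ≤-refl a) ⟩
      x ℤ.- x                                                 ≡⟨ ℤ.+-inverseʳ x ⟩
      0ℤ                                                      ∎
      where
      open ≡-Reasoning
      y*partial[1+n]≡x : y ℤ.* (+ partial n ℤ.+ + (p ^ N)) ≡ x
      y*partial[1+n]≡x = begin
        y ℤ.* (+ partial n ℤ.+ + (p ^ N)) ≡⟨ cong (y ℤ.*_) (ℤ.pos-+ (partial n) (p ^ N)) ⟨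
        y ℤ.* + (partial n + p ^ N)       ≡⟨ cong (λ t → y ℤ.* + t) (partial-suc n) ⟨
        y ℤ.* + partial (suc n)           ≡⟨ Approx⇒exact-at-gap (suc n) {x} {y} (n≤1+n n) a′ ⟩
        x                                 ∎

    witness : ∃[ k ] ¬ Approx p ξ∞ k y x
    witness with Approx? ξ∞ N y x | Approx? ξ∞ (suc (suc (suc n)) !) y x
    ... | no ¬a | _      = N , ¬a
    ... | yes _ | no ¬a′ = suc (suc (suc n)) ! , ¬a′
    ... | yes a | yes a′ = contradiction (ℤ.*-cancelʳ-≡ y 0ℤ (+ (p ^ N)) {{m^n≢0 p N}} (y*p^N≡0 a a′)) y≢0

  approx-at-gap : ∀ n m → Approx p ξ∞ (suc (suc n) ! + m) (+ (p ^ m)) (+ (p ^ m * partial n))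
  approx-at-gap n m with truncℕ-+ ξ∞ (suc (suc n) !) m
  ... | r , t[N+m]≡ = ∣⇒Approx {ξ∞} {N + m} {+ pᵐ} {+ (pᵐ * q)} (divides (+ r) residual)
    where
    open ≡-Reasoning
    N = suc (suc n) !
    pᵐ = p ^ m
    q = partial n
    shifted : pᵐ * truncℕ ξ∞ (N + m) ≡ pᵐ * q + r * p ^ (N + m)
    shifted = begin
      pᵐ * truncℕ ξ∞ (N + m)         ≡⟨ cong (pᵐ *_) t[N+m]≡ ⟩
      pᵐ * (truncℕ ξ∞ N + r * p ^ N) ≡⟨ cong (λ t → pᵐ * (t + r * p ^ N)) (truncℕ-gap n ([1+n]!<[2+n]! n) ≤-refl) ⟩
      pᵐ * (q + r * p ^ N)           ≡⟨ distribute pᵐ q r (p ^ N) ⟩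
      pᵐ * q + r * (p ^ N * pᵐ)      ≡⟨ cong (λ t → pᵐ * q + r * t) (^-distribˡ-+-* p N m) ⟨
      pᵐ * q + r * p ^ (N + m)       ∎
      where
      distribute : ∀ a q r b → a * (q + r * b) ≡ a * q + r * (b * a)
      distribute = solve-∀
    cancel : ∀ a b → (a ℤ.+ b) ℤ.- a ≡ b
    cancel = ℤ-solve-∀
    residual : + pᵐ ℤ.* + truncℕ ξ∞ (N + m) ℤ.- + (pᵐ * q) ≡ + r ℤ.* + (p ^ (N + m))
    residual = begin
      + pᵐ ℤ.* + truncℕ ξ∞ (N + m) ℤ.- + (pᵐ * q)         ≡⟨ cong (ℤ._- + (pᵐ * q)) (ℤ.pos-* pᵐ _) ⟨
      + (pᵐ * truncℕ ξ∞ (N + m)) ℤ.- + (pᵐ * q)           ≡⟨ cong (λ t → + t ℤ.- + (pᵐ * q)) shifted ⟩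
      + (pᵐ * q + r * p ^ (N + m)) ℤ.- + (pᵐ * q)         ≡⟨ cong (ℤ._- + (pᵐ * q)) (ℤ.pos-+ (pᵐ * q) _) ⟩
      (+ (pᵐ * q) ℤ.+ + (r * p ^ (N + m))) ℤ.- + (pᵐ * q) ≡⟨ cancel (+ (pᵐ * q)) _ ⟩
      + (r * p ^ (N + m))                                 ≡⟨ ℤ.pos-* r _ ⟩
      + r ℤ.* + (p ^ (N + m))                             ∎

  pair-size : ∀ n m → ∣ + (p ^ m * partial n) ℤ.* + (p ^ m) ∣ ≤ p ^ (m + suc (suc n !) + m)
  pair-size n m = begin
    ∣ + (p ^ m * partial n) ℤ.* + (p ^ m) ∣ ≡⟨ ℤ.abs-* (+ (p ^ m * partial n)) (+ (p ^ m)) ⟩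
    p ^ m * partial n * p ^ m               ≤⟨ *-monoˡ-≤ (p ^ m) (*-monoʳ-≤ (p ^ m) (<⇒≤ (partial<p^ n))) ⟩
    p ^ m * p ^ K * p ^ m                   ≡⟨ cong (_* p ^ m) (^-distribˡ-+-* p m K) ⟨
    p ^ (m + K) * p ^ m                     ≡⟨ ^-distribˡ-+-* p (m + K) m ⟨
    p ^ (m + K + m)                         ∎
    where
    open ≤-Reasoning
    K = suc (suc n !)

  approximation-at-scale : ∀ {a c} → a < 3 * c → ∀ {e} → 8 * c ≤ e → (2 * c) ! ≤ e →
    ∃[ x ] ∃[ y ] (x ≢ 0ℤ × y ≢ 0ℤ × ∣ x ℤ.* y ∣ ≤ p ^ (2 * e) ×
                   ∃[ k ] (suc e * a ≤ k * c × Approx p ξ∞ k y x))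
  approximation-at-scale {a} {c} a<3c {e} 8c≤e [2c]!≤e with !-bracket (2 * e) (*-monoʳ-≤ 2 (≤-trans (1≤n! (2 * c)) [2c]!≤e))
  ... | n , M<2e , 2e≤N with split-evenly M<2e
  ...   | m , size-exponent , 2e≤m+[2+M]+m =
    + (p ^ m * partial n) , + (p ^ m) ,
    pos≢0 (*-mono-≤ (m^n>0 p m) (≤-trans (m^n>0 p (suc n !)) (p^[1+n]!≤partial n))) , pos≢0 (m^n>0 p m) ,
    ≤-trans (pair-size n m) (^-monoʳ-≤ p size-exponent) ,
    suc (suc n) ! + m , lower-exponent a<3c 8c≤e 2e≤m+[2+M]+m 2e≤N (*-monoˡ-≤ (suc n !) 2c≤2+n) , approx-at-gap n m
    where
    open ≤-Reasoning
    2c≤2+n : 2 * c ≤ suc (suc n)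
    2c≤2+n = <⇒≤ (!-cancel-< (begin-strict
      (2 * c) !     ≤⟨ [2c]!≤e ⟩
      e             <⟨ m<n+m e (≤-trans (1≤n! (2 * c)) [2c]!≤e) ⟩
      e + e         ≡⟨ cong (λ z → e + z) (+-identityʳ e) ⟨
      2 * e         ≤⟨ 2e≤N ⟩
      suc (suc n) ! ∎))

  rescale : ∀ {a c e X x y} → p ^ e ≤ X → X < p ^ suc e →
            ∣ x ℤ.* y ∣ ≤ p ^ (2 * e) → ∃[ k ] (suc e * a ≤ k * c × Approx p ξ∞ k y x) →
            ∣ x ℤ.* y ∣ ≤ X ^ 2 × SmallAt p ξ∞ a c X y x
  rescale {a} {c} {e} {X} {x} {y} p^e≤X X<p^[1+e] xy≤p^2e (k , [1+e]a≤kc , approx) = xy≤X² , k , Xᵃ≤p^kc , approx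
    where
    open ≤-Reasoning
    xy≤X² : ∣ x ℤ.* y ∣ ≤ X ^ 2
    xy≤X² = begin
      ∣ x ℤ.* y ∣ ≤⟨ xy≤p^2e ⟩
      p ^ (2 * e) ≡⟨ cong (p ^_) (*-comm 2 e) ⟩
      p ^ (e * 2) ≡⟨ ^-*-assoc p e 2 ⟨
      (p ^ e) ^ 2 ≤⟨ ^-monoˡ-≤ 2 p^e≤X ⟩
      X ^ 2       ∎
    Xᵃ≤p^kc : X ^ a ≤ p ^ (k * c)
    Xᵃ≤p^kc = begin
      X ^ a           ≤⟨ ^-monoˡ-≤ a (<⇒≤ X<p^[1+e]) ⟩
      (p ^ suc e) ^ a ≡⟨ ^-*-assoc p (suc e) a ⟩
      p ^ (suc e * a) ≤⟨ ^-monoʳ-≤ p [1+e]a≤kc ⟩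
      p ^ (k * c)     ∎

  ξ∞-uniformMult : ∀ a b → a < 3 * suc b → UniformMult p ξ∞ a (suc b)
  ξ∞-uniformMult a b a<3c = p ^ E , solution
    where
    c = suc b
    E = 8 * c + (2 * c) !
    solution : ∀ X → p ^ E ≤ X →
               ∃[ x ] ∃[ y ] (x ≢ 0ℤ × y ≢ 0ℤ × ∣ x ℤ.* y ∣ ≤ X ^ 2 × SmallAt p ξ∞ a c X y x)
    solution X p^E≤X with log-bracket X (≤-trans (m^n>0 p E) p^E≤X)
    ... | e , p^e≤X , X<p^[1+e] =
      let x , y , x≢0 , y≢0 , xy≤p^2e , approx =
            approximation-at-scale {a} {c} a<3c {e} (≤-trans (m≤m+n (8 * c) ((2 * c) !)) E≤e) (≤-trans (m≤n+m _ (8 * c)) E≤e)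
      in  x , y , x≢0 , y≢0 , rescale {a} {c} {e} {X} {x} {y} p^e≤X X<p^[1+e] xy≤p^2e approx
      where
      E≤e : E ≤ e
      E≤e = ≤-pred (^-cancelʳ-< {E} {suc e} (≤-<-trans p^E≤X X<p^[1+e]))

  Approx⇒congruence : ∀ n {g r x y} → 1 ≤ g → g + r ≡ suc (suc n) ! → Approx p ξ∞ (suc (suc n) ! + g) y x →
    ∃[ s ] y ℤ.* (+ partial n ℤ.+ + (p ^ g) ℤ.* + (p ^ r)) ℤ.- x ≡ s ℤ.* (+ (p ^ g) ℤ.* + (p ^ r) ℤ.* + (p ^ g))
  Approx⇒congruence n {g} {r} {x} {y} g≥1 g+r≡N approx =
    quotient , close {quotient} equality
    where
    N = suc (suc n) !
    open _∣ℤ_ (Approx⇒∣ {ξ∞} {N + g} {y} {x} approx)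
    G = p ^ g
    R = p ^ r
    q = partial n
    p^N≡GR : p ^ N ≡ G * R
    p^N≡GR = trans (cong (p ^_) (sym g+r≡N)) (^-distribˡ-+-* p g r)
    truncℕ-N+g : truncℕ ξ∞ (N + g) ≡ q + G * R
    truncℕ-N+g = begin
      truncℕ ξ∞ (N + g) ≡⟨ truncℕ-gap (suc n) (subst (_≤ N + g) (+-comm N 1) (+-monoʳ-≤ N g≥1))
                                        (+-monoʳ-≤ N (≤-trans (m≤m+n g r) (≤-trans (≤-reflexive g+r≡N) (m≤n*m N (suc (suc n)))))) ⟩
      partial (suc n)   ≡⟨ partial-suc n ⟩
      q + p ^ N         ≡⟨ cong (λ t → q + t) p^N≡GR ⟩
      q + G * R         ∎
      where open ≡-Reasoning
    close : ∀ {s} → y ℤ.* + truncℕ ξ∞ (N + g) ℤ.- x ≡ s ℤ.* + (p ^ (N + g)) →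
            y ℤ.* (+ q ℤ.+ + G ℤ.* + R) ℤ.- x ≡ s ℤ.* (+ G ℤ.* + R ℤ.* + G)
    close {s} residual≡ = begin
      y ℤ.* (+ q ℤ.+ + G ℤ.* + R) ℤ.- x ≡⟨ cong (λ t → y ℤ.* t ℤ.- x)
                                               (trans (ℤ.pos-+ q (G * R)) (cong (λ t → + q ℤ.+ t) (ℤ.pos-* G R))) ⟨
      y ℤ.* + (q + G * R) ℤ.- x         ≡⟨ cong (λ t → y ℤ.* + t ℤ.- x) truncℕ-N+g ⟨
      y ℤ.* + truncℕ ξ∞ (N + g) ℤ.- x   ≡⟨ residual≡ ⟩
      s ℤ.* + (p ^ (N + g))             ≡⟨ cong (λ t → s ℤ.* + t) (trans (^-distribˡ-+-* p N g) (cong (_* G) p^N≡GR)) ⟩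
      s ℤ.* + (G * R * G)               ≡⟨ cong (s ℤ.*_) (trans (ℤ.pos-* (G * R) G) (cong (ℤ._* + G) (ℤ.pos-* G R))) ⟩
      s ℤ.* (+ G ℤ.* + R ℤ.* + G)       ∎
      where open ≡-Reasoning

  -- An exponent above 3 forces the approximation down to level N + g, where CloseSmallPair applies with G = p^g.
  no-approximation-at : ∀ {a c} → 3 * c < a → ∀ n g → 2 * g + 2 ≤ suc (suc n) ! → suc (suc n) ! ≤ 2 * g + 3 →
    2 * c < g → 2 * suc n ! + 3 ≤ g →
    ∀ {x y} → x ≢ 0ℤ → y ≢ 0ℤ → ∣ x ℤ.* y ∣ ≤ (p ^ g) ^ 2 → ¬ SmallAt p ξ∞ a c (p ^ g) y x
  no-approximation-at {a} {c} 3c<a n g 2g+2≤N N≤2g+3 2c<g 2M+3≤g {x} {y} x≢0 y≢0 xy≤G² (k , Gᵃ≤p^kc , approx) =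
    let s , close = Approx⇒congruence n {g} {N ∸ g} {x} {y} (≤-trans (s≤s z≤n) 2c<g) g+[N∸g]≡N approx-at-N+g
    in  CloseSmallPair.impossible {G} {R} {partial n} {U} (m^n>0 p g) (4p^g≤p^r 2+g≤N∸g) (2≤partial n) (partial<p^ n)
          (2[p^[1+M]]²≤p^g {M} 2M+3≤g) {x} {y} {s} x≢0 y≢0
          (subst (_≤ G * G) (ℤ.abs-* x y) (subst (∣ x ℤ.* y ∣ ≤_) (cong (G *_) (*-identityʳ G)) xy≤G²)) close
    where
    M = suc n !
    N = suc (suc n) !
    G = p ^ g
    R = p ^ (N ∸ g)
    U = p ^ suc M
    regroup : ∀ g → g + (2 + g) ≡ 2 * g + 2
    regroup = solve-∀
    g+[N∸g]≡N : g + (N ∸ g) ≡ N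
    g+[N∸g]≡N = m+[n∸m]≡n (≤-trans (m≤m+n g (2 + g)) (≤-trans (≤-reflexive (regroup g)) 2g+2≤N))
    2+g≤N∸g : 2 + g ≤ N ∸ g
    2+g≤N∸g = +-cancelˡ-≤ g _ _ (≤-trans (≤-reflexive (regroup g)) (≤-trans 2g+2≤N (≤-reflexive (sym g+[N∸g]≡N))))
    N+g≤k : N + g ≤ k
    N+g≤k = upper-exponent 3c<a 2c<g N≤2g+3 (^-cancelʳ-≤ (subst (_≤ p ^ (k * c)) (^-*-assoc p g a) Gᵃ≤p^kc))
    approx-at-N+g : Approx p ξ∞ (N + g) y x
    approx-at-N+g = Approx-≤ ξ∞ (N + g) (k ∸ (N + g)) {y} {x}
                      (subst (λ l → Approx p ξ∞ l y x) (sym (m+[n∸m]≡n N+g≤k)) approx)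

  ¬uniform-beyond : ∀ {a c} → 3 * c < a → ∀ X₀ n → 15 + 4 * c + 2 * X₀ ≤ suc (suc n) →
    ¬ (∀ X → X₀ ≤ X → ∃[ x ] ∃[ y ] (x ≢ 0ℤ × y ≢ 0ℤ × ∣ x ℤ.* y ∣ ≤ X ^ 2 × SmallAt p ξ∞ a c X y x))
  ¬uniform-beyond {a} {c} 3c<a X₀ n n-large solution with near-half (suc (suc n) !) (≤-trans (s≤s (s≤s z≤n)) (n<[1+n]! (suc n)))
  ... | g , 2g+2≤N , N≤2g+3 =
    let x , y , x≢0 , y≢0 , xy≤G² , small = solution (p ^ g) X₀≤p^g
    in  no-approximation-at 3c<a n g 2g+2≤N N≤2g+3 2c<g 2M+3≤g x≢0 y≢0 xy≤G² small
    where
    open ≤-Reasoning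
    M = suc n !
    N = suc (suc n) !
    below-g : ∀ {t} → 2 * t + 3 ≤ N → t ≤ g
    below-g 2t+3≤N = *-cancelˡ-≤ 2 (+-cancelʳ-≤ 3 _ _ (≤-trans 2t+3≤N N≤2g+3))
    M≥1 : 1 ≤ M
    M≥1 = 1≤n! (suc n)
    6+2c+X₀≤g : 6 + 2 * c + X₀ ≤ g
    6+2c+X₀≤g = below-g (begin
      2 * (6 + 2 * c + X₀) + 3 ≡⟨ expand c X₀ ⟩
      15 + 4 * c + 2 * X₀      ≤⟨ n-large ⟩
      suc (suc n)              ≤⟨ m≤m*n (suc (suc n)) M {{ℕ.>-nonZero M≥1}} ⟩
      N                        ∎)
      where
      expand : ∀ c X₀ → 2 * (6 + 2 * c + X₀) + 3 ≡ 15 + 4 * c + 2 * X₀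
      expand = solve-∀
    2M+3≤g : 2 * M + 3 ≤ g
    2M+3≤g = below-g (begin
      2 * (2 * M + 3) + 3 ≡⟨ expand M ⟩
      4 * M + 9           ≤⟨ +-monoʳ-≤ (4 * M) (m≤m*n 9 M {{ℕ.>-nonZero M≥1}}) ⟩
      4 * M + 9 * M       ≡⟨ *-distribʳ-+ M 4 9 ⟨
      13 * M              ≤⟨ *-monoˡ-≤ M (≤-trans (m≤m+n 13 (2 + 4 * c + 2 * X₀)) n-large) ⟩
      N                   ∎)
      where
      expand : ∀ M → 2 * (2 * M + 3) + 3 ≡ 4 * M + 9
      expand = solve-∀
    2c<g : 2 * c < g
    2c<g = ≤-trans (s≤s (≤-trans (m≤n+m (2 * c) 5) (m≤m+n _ X₀))) 6+2c+X₀≤g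
    X₀≤p^g : X₀ ≤ p ^ g
    X₀≤p^g = ≤-trans (≤-trans (m≤n+m X₀ (6 + 2 * c)) 6+2c+X₀≤g) (<⇒≤ (n<p^n g))

  ξ∞-¬uniformMult : ∀ a b → 3 * suc b < a → ¬ UniformMult p ξ∞ a (suc b)
  ξ∞-¬uniformMult a b 3c<a (X₀ , solution) = ¬uniform-beyond 3c<a X₀ (13 + 4 * suc b + 2 * X₀) ≤-refl solution

corollary2p2 : (p : ℕ) → Prime p → Irrational p ξ∞ × MuHatTimesIs3 p ξ∞
corollary2p2 p (prime _) = ξ∞-irrational p , ξ∞-uniformMult p , ξ∞-¬uniformMult p
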